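{- Let $R:(\mathbb N\to\mathbb N)\to\mathrm{Prop}$ be a Diophantine relation (given with its witness formula). Then one can compute a single Diophantine equation $p\doteq q$, with variables and parameters indexed by $\mathbb N$, such that for all $\nu:\mathbb N\to\mathbb N$, $$R\,\nu\iff\exists\varphi:\mathbb N\to\mathbb N,\ [\![p]\!]^\varphi_\nu=[\![q]\!]^\varphi_\nu.$$
   Context: Diophantine logic formulas are $A,B::= x_i\doteq n\mid x_i\doteq x_j\mid x_i\doteq x_j\dot+x_k\mid x_i\doteq x_j\dot\times x_k\mid A\dot\wedge B\mid A\dot\vee B\mid\dot\exists A$, with De Bruijn indices. For $\nu:\mathbb N\to\mathbb N$ the semantics is as follows. - Atoms have their obvious meaning, e.g. $[\![x_i\doteq x_j\dot+x_k]\!]\nu\iff\nu(i)=\nu(j)+\nu(k)$. - $\dot\wedge$ and $\dot\vee$ are interpreted as $\wedge$ and $\vee$. - $[\![\dot\exists A]\!]\nu\iff\exists n,\ [\![A]\!](n\cdot\nu)$, with $(n\cdot\nu)(0)=n$ and $(n\cdot\nu)(i+1)=\nu(i)$. $R$ is Diophantine if one is given a formula $A$ with $[\![A]\!]\nu\leftrightarrow R\,\nu$ for all $\nu$. Polynomials over variable type $U$ and parameter type $V$ are $p::=u\in U\mid x\in V\mid n\in\mathbb N\mid p\dot+p\mid p\dot\times p$, evaluated in $\mathbb N$ as $[\![p]\!]^\varphi_\nu$ under $\varphi:U\to\mathbb N$ and $\nu:V\to\mathbb N$. Here $U=V=\mathbb N$. -}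

module Defs where

open import Data.Nat using (ℕ; zero; suc; _+_; _*_)
open import Data.Product using (_×_; ∃)
open import Data.Sum using (_⊎_)
open import Relation.Binary.PropositionalEquality using (_≡_)
open import Function.Bundles using (_⇔_)

-- Diophantine logic formulas, variables as De Bruijn indices
data DForm : Set where
  _≐ₙ_   : ℕ → ℕ → DForm
  _≐ᵥ_   : ℕ → ℕ → DForm
  _≐_+̇_ : ℕ → ℕ → ℕ → DForm
  _≐_*̇_ : ℕ → ℕ → ℕ → DForm
  _∧̇_    : DForm → DForm → DForm
  _∨̇_    : DForm → DForm → DForm
  ∃̇      : DForm → DForm

_·_ : ℕ → (ℕ → ℕ) → (ℕ → ℕ)
(n · ν) zero    = n
(n · ν) (suc i) = ν i

⟦_⟧ : DForm → (ℕ → ℕ) → Set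
⟦ i ≐ₙ n ⟧ ν      = ν i ≡ n
⟦ i ≐ᵥ j ⟧ ν      = ν i ≡ ν j
⟦ i ≐ j +̇ k ⟧ ν  = ν i ≡ ν j + ν k
⟦ i ≐ j *̇ k ⟧ ν  = ν i ≡ ν j * ν k
⟦ A ∧̇ B ⟧ ν       = ⟦ A ⟧ ν × ⟦ B ⟧ ν
⟦ A ∨̇ B ⟧ ν       = ⟦ A ⟧ ν ⊎ ⟦ B ⟧ ν
⟦ ∃̇ A ⟧ ν         = ∃ λ n → ⟦ A ⟧ (n · ν)

record Diophantine (R : (ℕ → ℕ) → Set) : Set where
  field
    formula : DForm
    correct : ∀ ν → ⟦ formula ⟧ ν ⇔ R ν

data Poly (U V : Set) : Set where
  var   : U → Poly U V
  par   : V → Poly U V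
  cst   : ℕ → Poly U V
  _⊕_   : Poly U V → Poly U V → Poly U V
  _⊗_   : Poly U V → Poly U V → Poly U V

⟦_⟧ᵖ : ∀ {U V : Set} → Poly U V → (U → ℕ) → (V → ℕ) → ℕ
⟦ var u ⟧ᵖ φ ν = φ u
⟦ par x ⟧ᵖ φ ν = ν x
⟦ cst n ⟧ᵖ φ ν = n
⟦ p ⊕ q ⟧ᵖ φ ν = ⟦ p ⟧ᵖ φ ν + ⟦ q ⟧ᵖ φ ν
⟦ p ⊗ q ⟧ᵖ φ ν = ⟦ p ⟧ᵖ φ ν * ⟦ q ⟧ᵖ φ ν

-- Over ℕ, p = q iff p² + q² = 2pq, and p² + q² exceeds 2pq by exactly (p − q)². So a conjunction
-- of two equations is the single equation saying that their excesses sum to zero, and a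
-- disjunction the one saying that they multiply to zero: (S₁ − D₁)(S₂ − D₂) = 0, expanded so
-- that no subtraction occurs. The two equations are first given disjoint unknowns (even and odd
-- indices), and ∃̇ turns the parameter x₀ into a fresh unknown.
module Submission where

open import Defs
open import Data.Nat using (ℕ; zero; suc; _+_; _*_; ∣_-_∣; _≤_)
open import Data.Nat.Properties
  using (≤-total; m≤n⇒∃[o]m+o≡n; ∣m-m+n∣≡n; ∣-∣-comm; *-comm; +-comm; +-identityʳ; *-zeroʳ;
         +-cancelˡ-≡; m+n≡0⇒m≡0; m+n≡0⇒n≡0; m*n≡0⇒m≡0∨n≡0; m≡n⇒∣m-n∣≡0; ∣m-n∣≡0⇒m≡n)
open import Data.Nat.Tactic.RingSolver using (solve-∀)
open import Data.Product using (Σ; ∃; _,_; _×_; proj₁; proj₂)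
open import Data.Product.Function.Dependent.Propositional using (congˡ)
open import Data.Product.Function.NonDependent.Propositional using (_×-⇔_)
open import Data.Sum using (_⊎_; inj₁; inj₂; [_,_]′; reduce)
open import Data.Sum.Function.Propositional using (_⊎-⇔_)
open import Function using (_∘_; const)
open import Function.Bundles using (_⇔_; mk⇔; Equivalence)
open import Function.Properties.Equivalence using (⇔-setoid) renaming (sym to ⇔-sym)
open import Level using (0ℓ)
open import Relation.Binary.PropositionalEquality using (_≡_; refl; sym; trans; cong; cong₂)
open import Relation.Binary.Reasoning.Setoid (⇔-setoid 0ℓ)
  using (begin_; _∎; step-≈-⟩; step-≈-⟨)

≡-resp-⇔ : ∀ {a a′ b b′ : ℕ} → a ≡ a′ → b ≡ b′ → (a ≡ b) ⇔ (a′ ≡ b′)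
≡-resp-⇔ p q = mk⇔ (λ e → trans (sym p) (trans e q)) (λ e → trans p (trans e (sym q)))

+-cancelˡ-⇔ : ∀ k {m n} → (k + m ≡ k + n) ⇔ (m ≡ n)
+-cancelˡ-⇔ k = mk⇔ (+-cancelˡ-≡ k _ _) (cong (k +_))

m+n≡0⇔m≡0×n≡0 : ∀ m n → (m + n ≡ 0) ⇔ (m ≡ 0 × n ≡ 0)
m+n≡0⇔m≡0×n≡0 m n = mk⇔ (λ e → m+n≡0⇒m≡0 m e , m+n≡0⇒n≡0 m e) (λ { (refl , refl) → refl })

m*n≡0⇔m≡0⊎n≡0 : ∀ m n → (m * n ≡ 0) ⇔ (m ≡ 0 ⊎ n ≡ 0)
m*n≡0⇔m≡0⊎n≡0 m n = mk⇔ (m*n≡0⇒m≡0∨n≡0 m) [ (λ { refl → refl }) , (λ { refl → *-zeroʳ m }) ]′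

distSq : ℕ → ℕ → ℕ
distSq a b = ∣ a - b ∣ * ∣ a - b ∣

≡⇔distSq≡0 : ∀ a b → (a ≡ b) ⇔ (distSq a b ≡ 0)
≡⇔distSq≡0 a b = mk⇔ (λ e → cong (λ d → d * d) (m≡n⇒∣m-n∣≡0 e)) (∣m-n∣≡0⇒m≡n ∘ square≡0)
  where
  square≡0 : ∀ {d} → d * d ≡ 0 → d ≡ 0
  square≡0 {d} e = reduce (m*n≡0⇒m≡0∨n≡0 d e)

sumSq twiceProd : ℕ → ℕ → ℕ
sumSq a b = a * a + b * b
twiceProd a b = 2 * (a * b)

sumSq≡twiceProd+distSq-≤ : ∀ {a b} → a ≤ b → sumSq a b ≡ twiceProd a b + distSq a b
sumSq≡twiceProd+distSq-≤ {a} a≤b with m≤n⇒∃[o]m+o≡n a≤b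
... | k , refl = trans (expand a k) (cong (λ d → 2 * (a * (a + k)) + d * d) (sym (∣m-m+n∣≡n a k)))
  where
  expand : ∀ a k → a * a + (a + k) * (a + k) ≡ 2 * (a * (a + k)) + k * k
  expand = solve-∀

sumSq≡twiceProd+distSq : ∀ a b → sumSq a b ≡ twiceProd a b + distSq a b
sumSq≡twiceProd+distSq a b with ≤-total a b
... | inj₁ a≤b = sumSq≡twiceProd+distSq-≤ a≤b
... | inj₂ b≤a = trans (+-comm (a * a) (b * b)) (trans (sumSq≡twiceProd+distSq-≤ b≤a)
  (cong₂ (λ p d → 2 * p + d * d) (*-comm b a) (∣-∣-comm b a)))

+-excess-⇔ : ∀ B X D Y {A C} → A ≡ B + X → C ≡ D + Y → (A + C ≡ B + D) ⇔ (X + Y ≡ 0)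
+-excess-⇔ B X D Y refl refl = begin
  (B + X) + (D + Y) ≡ B + D        ≈⟨ ≡-resp-⇔ (shuffle B X D Y) (sym (+-identityʳ (B + D))) ⟩
  (B + D) + (X + Y) ≡ (B + D) + 0  ≈⟨ +-cancelˡ-⇔ (B + D) ⟩
  X + Y ≡ 0                        ∎
  where
  shuffle : ∀ B X D Y → (B + X) + (D + Y) ≡ (B + D) + (X + Y)
  shuffle = solve-∀

*-excess-⇔ : ∀ B X D Y {A C} → A ≡ B + X → C ≡ D + Y →
  (A * C + B * D ≡ B * C + A * D) ⇔ (X * Y ≡ 0)
*-excess-⇔ B X D Y refl refl = begin
  (B + X) * (D + Y) + B * D ≡ B * (D + Y) + (B + X) * D  ≈⟨ ≡-resp-⇔ (expandˡ B X D Y) (expandʳ B X D Y) ⟩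
  K + X * Y ≡ K + 0                                      ≈⟨ +-cancelˡ-⇔ K ⟩
  X * Y ≡ 0                                              ∎
  where
  K : ℕ
  K = 2 * (B * D) + B * Y + X * D
  expandˡ : ∀ B X D Y → (B + X) * (D + Y) + B * D ≡ (2 * (B * D) + B * Y + X * D) + X * Y
  expandˡ = solve-∀
  expandʳ : ∀ B X D Y → B * (D + Y) + (B + X) * D ≡ (2 * (B * D) + B * Y + X * D) + 0
  expandʳ = solve-∀

×-≡⇔sumSq≡twiceProd : ∀ a b c d →
  (a ≡ b × c ≡ d) ⇔ (sumSq a b + sumSq c d ≡ twiceProd a b + twiceProd c d)
×-≡⇔sumSq≡twiceProd a b c d = begin
  (a ≡ b × c ≡ d)                    ≈⟨ ≡⇔distSq≡0 a b ×-⇔ ≡⇔distSq≡0 c d ⟩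
  (distSq a b ≡ 0 × distSq c d ≡ 0)  ≈⟨ m+n≡0⇔m≡0×n≡0 (distSq a b) (distSq c d) ⟨
  distSq a b + distSq c d ≡ 0        ≈⟨ +-excess-⇔ (twiceProd a b) (distSq a b) (twiceProd c d) (distSq c d)
                                           (sumSq≡twiceProd+distSq a b) (sumSq≡twiceProd+distSq c d) ⟨
  sumSq a b + sumSq c d ≡ twiceProd a b + twiceProd c d ∎

⊎-≡⇔sumSq≡twiceProd : ∀ a b c d →
  (a ≡ b ⊎ c ≡ d) ⇔ (sumSq a b * sumSq c d + twiceProd a b * twiceProd c d
                     ≡ twiceProd a b * sumSq c d + sumSq a b * twiceProd c d)
⊎-≡⇔sumSq≡twiceProd a b c d = begin
  (a ≡ b ⊎ c ≡ d)                    ≈⟨ ≡⇔distSq≡0 a b ⊎-⇔ ≡⇔distSq≡0 c d ⟩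
  (distSq a b ≡ 0 ⊎ distSq c d ≡ 0)  ≈⟨ m*n≡0⇔m≡0⊎n≡0 (distSq a b) (distSq c d) ⟨
  distSq a b * distSq c d ≡ 0        ≈⟨ *-excess-⇔ (twiceProd a b) (distSq a b) (twiceProd c d) (distSq c d)
                                           (sumSq≡twiceProd+distSq a b) (sumSq≡twiceProd+distSq c d) ⟨
  _                                  ∎

Equation : Set → Set → Set
Equation U V = Poly U V × Poly U V

Solves : ∀ {U V : Set} → Equation U V → (U → ℕ) → (V → ℕ) → Set
Solves (p , q) φ ν = ⟦ p ⟧ᵖ φ ν ≡ ⟦ q ⟧ᵖ φ ν

Defines : ∀ {V : Set} → Equation ℕ V → ((V → ℕ) → Set) → Set
Defines e R = ∀ ν → R ν ⇔ ∃ λ φ → Solves e φ ν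

sumSqᵖ twiceProdᵖ : ∀ {U V : Set} → Poly U V → Poly U V → Poly U V
sumSqᵖ p q = (p ⊗ p) ⊕ (q ⊗ q)
twiceProdᵖ p q = cst 2 ⊗ (p ⊗ q)

_∧ᵉ_ _∨ᵉ_ : ∀ {U V : Set} → Equation U V → Equation U V → Equation U V
(p , q) ∧ᵉ (r , s) = sumSqᵖ p q ⊕ sumSqᵖ r s , twiceProdᵖ p q ⊕ twiceProdᵖ r s
(p , q) ∨ᵉ (r , s) =
  (sumSqᵖ p q ⊗ sumSqᵖ r s) ⊕ (twiceProdᵖ p q ⊗ twiceProdᵖ r s) ,
  (twiceProdᵖ p q ⊗ sumSqᵖ r s) ⊕ (sumSqᵖ p q ⊗ twiceProdᵖ r s)

Solves-∧ᵉ : ∀ {U V : Set} (e e′ : Equation U V) φ ν →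
  Solves (e ∧ᵉ e′) φ ν ⇔ (Solves e φ ν × Solves e′ φ ν)
Solves-∧ᵉ (p , q) (r , s) φ ν =
  ⇔-sym (×-≡⇔sumSq≡twiceProd (⟦ p ⟧ᵖ φ ν) (⟦ q ⟧ᵖ φ ν) (⟦ r ⟧ᵖ φ ν) (⟦ s ⟧ᵖ φ ν))

Solves-∨ᵉ : ∀ {U V : Set} (e e′ : Equation U V) φ ν →
  Solves (e ∨ᵉ e′) φ ν ⇔ (Solves e φ ν ⊎ Solves e′ φ ν)
Solves-∨ᵉ (p , q) (r , s) φ ν =
  ⇔-sym (⊎-≡⇔sumSq≡twiceProd (⟦ p ⟧ᵖ φ ν) (⟦ q ⟧ᵖ φ ν) (⟦ r ⟧ᵖ φ ν) (⟦ s ⟧ᵖ φ ν))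

substitute : ∀ {U V U′ V′ : Set} → (U → Poly U′ V′) → (V → Poly U′ V′) → Poly U V → Poly U′ V′
substitute f g (var u) = f u
substitute f g (par x) = g x
substitute f g (cst n) = cst n
substitute f g (p ⊕ q) = substitute f g p ⊕ substitute f g q
substitute f g (p ⊗ q) = substitute f g p ⊗ substitute f g q

⟦substitute⟧ : ∀ {U V U′ V′ : Set} {f : U → Poly U′ V′} {g : V → Poly U′ V′} {φ ν φ′ ν′} →
  (∀ u → ⟦ f u ⟧ᵖ φ ν ≡ φ′ u) → (∀ v → ⟦ g v ⟧ᵖ φ ν ≡ ν′ v) →
  ∀ p → ⟦ substitute f g p ⟧ᵖ φ ν ≡ ⟦ p ⟧ᵖ φ′ ν′
⟦substitute⟧ f≗ g≗ (var u) = f≗ u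
⟦substitute⟧ f≗ g≗ (par x) = g≗ x
⟦substitute⟧ f≗ g≗ (cst n) = refl
⟦substitute⟧ f≗ g≗ (p ⊕ q) = cong₂ _+_ (⟦substitute⟧ f≗ g≗ p) (⟦substitute⟧ f≗ g≗ q)
⟦substitute⟧ f≗ g≗ (p ⊗ q) = cong₂ _*_ (⟦substitute⟧ f≗ g≗ p) (⟦substitute⟧ f≗ g≗ q)

substituteᵉ : ∀ {U V U′ V′ : Set} → (U → Poly U′ V′) → (V → Poly U′ V′) → Equation U V → Equation U′ V′
substituteᵉ f g (p , q) = substitute f g p , substitute f g q

Solves-substituteᵉ : ∀ {U V U′ V′ : Set} {f : U → Poly U′ V′} {g : V → Poly U′ V′} {φ ν φ′ ν′} →
  (∀ u → ⟦ f u ⟧ᵖ φ ν ≡ φ′ u) → (∀ v → ⟦ g v ⟧ᵖ φ ν ≡ ν′ v) →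
  ∀ e → Solves (substituteᵉ f g e) φ ν ⇔ Solves e φ′ ν′
Solves-substituteᵉ f≗ g≗ (p , q) = ≡-resp-⇔ (⟦substitute⟧ f≗ g≗ p) (⟦substitute⟧ f≗ g≗ q)

renameᵉ : ∀ {U U′ V : Set} → (U → U′) → Equation U V → Equation U′ V
renameᵉ r = substituteᵉ (var ∘ r) par

Solves-renameᵉ : ∀ {U U′ V : Set} {r : U → U′} {φ : U′ → ℕ} {φ′ : U → ℕ} {ν : V → ℕ} →
  (∀ u → φ (r u) ≡ φ′ u) → ∀ e → Solves (renameᵉ r e) φ ν ⇔ Solves e φ′ ν
Solves-renameᵉ φ∘r≗ = Solves-substituteᵉ φ∘r≗ (λ _ → refl)

double : ℕ → ℕ
double zero    = zero
double (suc n) = suc (suc (double n))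

interleave : (ℕ → ℕ) → (ℕ → ℕ) → ℕ → ℕ
interleave f g zero          = f 0
interleave f g (suc zero)    = g 0
interleave f g (suc (suc n)) = interleave (f ∘ suc) (g ∘ suc) n

interleave-double : ∀ f g u → interleave f g (double u) ≡ f u
interleave-double f g zero    = refl
interleave-double f g (suc u) = interleave-double (f ∘ suc) (g ∘ suc) u

interleave-suc-double : ∀ f g u → interleave f g (suc (double u)) ≡ g u
interleave-suc-double f g zero    = refl
interleave-suc-double f g (suc u) = interleave-suc-double (f ∘ suc) (g ∘ suc) u

evensᵉ oddsᵉ : ∀ {V : Set} → Equation ℕ V → Equation ℕ V
evensᵉ = renameᵉ double
oddsᵉ  = renameᵉ (suc ∘ double)

∃×∃⇔∃-interleaved : ∀ {V : Set} (e e′ : Equation ℕ V) ν →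
  ((∃ λ φ → Solves e φ ν) × (∃ λ ψ → Solves e′ ψ ν)) ⇔
  (∃ λ χ → Solves (evensᵉ e) χ ν × Solves (oddsᵉ e′) χ ν)
∃×∃⇔∃-interleaved e e′ ν = mk⇔
  (λ ((φ , s) , (ψ , t)) → interleave φ ψ ,
     from (Solves-renameᵉ (interleave-double φ ψ) e) s , from (Solves-renameᵉ (interleave-suc-double φ ψ) e′) t)
  (λ (χ , s , t) →
     (χ ∘ double , to (Solves-renameᵉ (λ _ → refl) e) s) , (χ ∘ suc ∘ double , to (Solves-renameᵉ (λ _ → refl) e′) t))
  where open Equivalence

∃⊎∃⇔∃-interleaved : ∀ {V : Set} (e e′ : Equation ℕ V) ν →
  ((∃ λ φ → Solves e φ ν) ⊎ (∃ λ ψ → Solves e′ ψ ν)) ⇔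
  (∃ λ χ → Solves (evensᵉ e) χ ν ⊎ Solves (oddsᵉ e′) χ ν)
∃⊎∃⇔∃-interleaved e e′ ν = mk⇔
  (λ { (inj₁ (φ , s)) → interleave φ (const 0) , inj₁ (from (Solves-renameᵉ (interleave-double φ _) e) s)
     ; (inj₂ (ψ , t)) → interleave (const 0) ψ , inj₂ (from (Solves-renameᵉ (interleave-suc-double _ ψ) e′) t) })
  (λ { (χ , inj₁ s) → inj₁ (χ ∘ double , to (Solves-renameᵉ (λ _ → refl) e) s)
     ; (χ , inj₂ t) → inj₂ (χ ∘ suc ∘ double , to (Solves-renameᵉ (λ _ → refl) e′) t) })
  where open Equivalence

Defines-∧ : ∀ {V : Set} {e e′ : Equation ℕ V} {R S : (V → ℕ) → Set} →
  Defines e R → Defines e′ S → Defines (evensᵉ e ∧ᵉ oddsᵉ e′) (λ ν → R ν × S ν)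
Defines-∧ {e = e} {e′} {R} {S} e-R e′-S ν = begin
  (R ν × S ν)                                                ≈⟨ e-R ν ×-⇔ e′-S ν ⟩
  ((∃ λ φ → Solves e φ ν) × (∃ λ ψ → Solves e′ ψ ν))        ≈⟨ ∃×∃⇔∃-interleaved e e′ ν ⟩
  (∃ λ χ → Solves (evensᵉ e) χ ν × Solves (oddsᵉ e′) χ ν)   ≈⟨ congˡ (Solves-∧ᵉ (evensᵉ e) (oddsᵉ e′) _ ν) ⟨
  (∃ λ χ → Solves (evensᵉ e ∧ᵉ oddsᵉ e′) χ ν)               ∎

Defines-∨ : ∀ {V : Set} {e e′ : Equation ℕ V} {R S : (V → ℕ) → Set} →
  Defines e R → Defines e′ S → Defines (evensᵉ e ∨ᵉ oddsᵉ e′) (λ ν → R ν ⊎ S ν)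
Defines-∨ {e = e} {e′} {R} {S} e-R e′-S ν = begin
  (R ν ⊎ S ν)                                                ≈⟨ e-R ν ⊎-⇔ e′-S ν ⟩
  ((∃ λ φ → Solves e φ ν) ⊎ (∃ λ ψ → Solves e′ ψ ν))        ≈⟨ ∃⊎∃⇔∃-interleaved e e′ ν ⟩
  (∃ λ χ → Solves (evensᵉ e) χ ν ⊎ Solves (oddsᵉ e′) χ ν)   ≈⟨ congˡ (Solves-∨ᵉ (evensᵉ e) (oddsᵉ e′) _ ν) ⟨
  (∃ λ χ → Solves (evensᵉ e ∨ᵉ oddsᵉ e′) χ ν)               ∎

parameter₀-as-unknown₀ : ℕ → Poly ℕ ℕ
parameter₀-as-unknown₀ zero    = var 0
parameter₀-as-unknown₀ (suc j) = par j

∃ᵉ : Equation ℕ ℕ → Equation ℕ ℕ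
∃ᵉ = substituteᵉ (var ∘ suc) parameter₀-as-unknown₀

Solves-∃ᵉ : ∀ e φ ν → Solves (∃ᵉ e) φ ν ⇔ Solves e (φ ∘ suc) (φ 0 · ν)
Solves-∃ᵉ e φ ν = Solves-substituteᵉ (λ _ → refl) (λ { zero → refl ; (suc _) → refl }) e

Defines-∃ : ∀ {e : Equation ℕ ℕ} {R : (ℕ → ℕ) → Set} →
  Defines e R → Defines (∃ᵉ e) (λ ν → ∃ λ n → R (n · ν))
Defines-∃ {e} e-R ν = mk⇔
  (λ (n , r) → let φ , s = to (e-R (n · ν)) r in n · φ , from (Solves-∃ᵉ e (n · φ) ν) s)
  (λ (φ , s) → φ 0 , from (e-R (φ 0 · ν)) (φ ∘ suc , to (Solves-∃ᵉ e φ ν) s))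
  where open Equivalence

without-unknowns : ∀ {P : Set} → P ⇔ (∃ λ (φ : ℕ → ℕ) → P)
without-unknowns = mk⇔ (const 0 ,_) proj₂

compile : DForm → Equation ℕ ℕ
compile (i ≐ₙ n)     = par i , cst n
compile (i ≐ᵥ j)     = par i , par j
compile (i ≐ j +̇ k) = par i , par j ⊕ par k
compile (i ≐ j *̇ k) = par i , par j ⊗ par k
compile (A ∧̇ B)      = evensᵉ (compile A) ∧ᵉ oddsᵉ (compile B)
compile (A ∨̇ B)      = evensᵉ (compile A) ∨ᵉ oddsᵉ (compile B)
compile (∃̇ A)        = ∃ᵉ (compile A)

compile-defines : ∀ A → Defines (compile A) ⟦ A ⟧
compile-defines (i ≐ₙ n)     ν = without-unknowns
compile-defines (i ≐ᵥ j)     ν = without-unknowns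
compile-defines (i ≐ j +̇ k) ν = without-unknowns
compile-defines (i ≐ j *̇ k) ν = without-unknowns
compile-defines (A ∧̇ B)      = Defines-∧ {e = compile A} {compile B} (compile-defines A) (compile-defines B)
compile-defines (A ∨̇ B)      = Defines-∨ {e = compile A} {compile B} (compile-defines A) (compile-defines B)
compile-defines (∃̇ A)        = Defines-∃ {compile A} (compile-defines A)

corollary4p4 : (R : (ℕ → ℕ) → Set) → Diophantine R →
    Σ (Poly ℕ ℕ) λ p → Σ (Poly ℕ ℕ) λ q →
      ∀ (ν : ℕ → ℕ) → R ν ⇔ (∃ λ (φ : ℕ → ℕ) → ⟦ p ⟧ᵖ φ ν ≡ ⟦ q ⟧ᵖ φ ν)
corollary4p4 R D = p , q , λ ν → begin
  R ν                          ≈⟨ correct ν ⟨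
  ⟦ formula ⟧ ν                ≈⟨ compile-defines formula ν ⟩
  (∃ λ φ → Solves (p , q) φ ν) ∎
  where
  open Diophantine D
  p q : Poly ℕ ℕ
  p = proj₁ (compile formula)
  q = proj₂ (compile formula)
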